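{- Let $A$ be a weakly connected antidirected oriented graph and let $\ell,n_0\in\mathbb N$. Suppose that for every oriented graph $D$ on at least $n_0$ vertices with $\delta^0(D)\ge\ell$ we have $A\subseteq_{1/8}D$. Then every oriented graph $D'$ on at least $n_0$ vertices with $\bar\delta^0(D')\ge\ell$ contains $A$ as a subdigraph.
   Context: An oriented graph is a digraph with no loops and at most one edge between any pair of vertices; it is weakly connected if its underlying undirected graph is connected, and antidirected if it contains no directed path with 2 edges. $\delta^0(D)$ is the minimum over all vertices of their in- and out-degrees. For a digraph with at least one edge, the minimum pseudo-semidegree $\bar\delta^0(D)$ is the minimum of all nonzero values among the in-degrees and out-degrees of its vertices (i.e. the largest $d$ such that every in- and out-degree lies in $\{0\}\cup[d,\infty)$); for a digraph with no edges it is $0$. For digraphs $A,D$ and $\gamma>0$, write $A\subseteq_\gamma D$ if for every set $V^*\subseteq V(D)$ with $|V^*|\ge\gamma|V(D)|$ and every $x\in V(A)$ there is an embedding of $A$ into $D$ (an injective map of vertices sending each edge $uv$ to an edge directed from the image of $u$ to the image of $v$) mapping $x$ into $V^*$. -}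

module Defs where

open import Data.Nat using (ℕ; zero; suc; _+_; _*_; _≤_; _⊓_)
open import Data.Bool using (Bool; true; false; if_then_else_)
open import Data.Fin using (Fin; zero; suc)
open import Data.Fin.Subset using (Subset; _∈_; ∣_∣)
open import Data.List using (List; []; _∷_; _++_; map; concatMap)
open import Data.List using (allFin)
open import Data.Product using (Σ; _×_; ∃; _,_)
open import Data.Empty using (⊥)
open import Relation.Nullary using (¬_)
open import Relation.Binary.PropositionalEquality using (_≡_)
open import Function.Definitions using (Injective)

-- A digraph on vertex set Fin size, edges given by a Boolean adjacency relation
-- (adj u v ≡ true means there is an edge directed from u to v).
record Digraph : Set where
  field
    size : ℕ
    adj  : Fin size → Fin size → Bool
open Digraph public

Edge : (D : Digraph) → Fin (size D) → Fin (size D) → Set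
Edge D u v = adj D u v ≡ true

Oriented : Digraph → Set
Oriented D = (∀ u → ¬ Edge D u u) × (∀ u v → Edge D u v → ¬ Edge D v u)

data Reach (D : Digraph) (u : Fin (size D)) : Fin (size D) → Set where
  here : Reach D u u
  fwd  : ∀ {v w} → Reach D u v → Edge D v w → Reach D u w
  bwd  : ∀ {v w} → Reach D u v → Edge D w v → Reach D u w

WeaklyConnected : Digraph → Set
WeaklyConnected D = ∀ u v → Reach D u v

-- no directed path with 2 edges (in an oriented graph u,v,w are automatically distinct)
Antidirected : Digraph → Set
Antidirected D = ∀ u v w → Edge D u v → ¬ Edge D v w

countB : ∀ {n} → (Fin n → Bool) → ℕ
countB {zero}  p = 0
countB {suc n} p = (if p zero then 1 else 0) + countB (λ i → p (suc i))

outdeg : (D : Digraph) → Fin (size D) → ℕ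
outdeg D v = countB (λ w → adj D v w)

indeg : (D : Digraph) → Fin (size D) → ℕ
indeg D v = countB (λ w → adj D w v)

MinSemidegreeAtLeast : Digraph → ℕ → Set
MinSemidegreeAtLeast D ℓ = ∀ v → (ℓ ≤ outdeg D v) × (ℓ ≤ indeg D v)

minNonzero : List ℕ → ℕ
minNonzero [] = 0
minNonzero (zero ∷ xs) = minNonzero xs
minNonzero (suc k ∷ xs) with minNonzero xs
... | zero  = suc k
... | suc m = suc k ⊓ suc m

pseudoSemidegree : Digraph → ℕ
pseudoSemidegree D =
  minNonzero (concatMap (λ v → outdeg D v ∷ indeg D v ∷ []) (allFin (size D)))

IsEmbedding : (A D : Digraph) → (Fin (size A) → Fin (size D)) → Set
IsEmbedding A D f = Injective _≡_ _≡_ f × (∀ u v → Edge A u v → Edge D (f u) (f v))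

Contains : Digraph → Digraph → Set
Contains D A = Σ (Fin (size A) → Fin (size D)) (IsEmbedding A D)

-- A ⊆_{1/8} D : for every V* with |V*| ≥ |V(D)|/8 and every x ∈ V(A),
-- some embedding maps x into V*
RobustEmbeds8 : Digraph → Digraph → Set
RobustEmbeds8 A D =
  (V* : Subset (size D)) → size D ≤ 8 * ∣ V* ∣ → (x : Fin (size A)) →
  Σ (Fin (size A) → Fin (size D)) (λ f → IsEmbedding A D f × (f x ∈ V*))

{-# OPTIONS --safe #-}
-- Pad D′ to an oriented graph D with |D| ≥ |D′|: take N + ℓ disjoint copies of D′ restricted to
-- its non-isolated vertices and a blow-up of a directed triangle with parts of size ℓ; the copies
-- of sinks of D′ send arcs to all of the blow-up and the copies of sources receive arcs from all
-- of it. Since every nonzero semidegree of D′ is at least ℓ, δ⁰(D) ≥ ℓ. A non-isolated vertex of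
-- D′ has out-arcs or in-arcs, so for one of the two kinds at least half of them have it, and their
-- copies form a set V* of at least |D|/8 vertices. Embed A with the tail (resp. head) of one of
-- its arcs in V*. Since A is antidirected every vertex of A is a source or a sink, and a copy of a
-- vertex with out-arcs (resp. in-arcs) in D′ has no arc to (resp. from) the blow-up; so by weak
-- connectivity all of A lands in one copy, which is an embedding into D′.

module Submission where

open import Defs
open import Data.Nat using (ℕ; zero; suc; _+_; _*_; _≤_; _<_; z≤n; s≤s; >-nonZero)
open import Data.Nat.Properties
  using ( ≤-trans; +-suc; n≤1+n; +-monoʳ-≤; +-monoˡ-≤; ≤-total; m⊓n≤m; m⊓n≤n; *-monoʳ-≤
        ; m≤m*n; m≤m+n; m≤n+m; module ≤-Reasoning)
open import Data.Nat.Solver using (module +-*-Solver)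
open import Data.Bool using (Bool; true; false; not; _∨_; _∧_)
open import Data.Bool.Properties using (∨-zeroʳ) renaming (_≟_ to _≟ᵇ_)
open import Data.Fin using (Fin; zero; suc)
open import Data.Fin.Patterns using (0F; 1F; 2F)
open import Data.Fin.Properties using (any?; injective⇒≤; suc-injective; _≟_; +↔⊎; *↔×)
open import Data.Sum.Function.Propositional using (_⊎-↔_)
open import Function.Bundles using (_↔_; Inverse; Injection)
open import Function.Properties.Inverse using (↔⇒↣; ↔-sym)
open import Function.Construct.Composition using (_↔-∘_)
open import Relation.Nullary using (¬_; Dec; does; yes; no)
open import Relation.Nullary.Decidable using (dec-true)
open import Data.Fin.Subset using (Subset; ∣_∣; ⊤)
open import Data.Fin.Subset.Properties using (∣⊤∣≡n)
open import Data.Vec using (tabulate)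
open import Data.Vec.Properties using (lookup∘tabulate; []=⇒lookup)
open import Data.List using ([]; _∷_)
open import Data.List.Relation.Unary.All as All using (All; []; _∷_)
import Data.List.Relation.Unary.All.Properties as All
open import Data.List.Relation.Unary.Any as Any using (Any; here; there)
import Data.List.Relation.Unary.Any.Properties as Any
open import Data.Product using (_×_; ∃; _,_; proj₁; proj₂; map₂)
open import Data.Sum using (_⊎_; inj₁; inj₂)
open import Data.Empty using (⊥-elim)
open import Function using (_∘_; flip)
open import Function.Definitions using (Injective)
open import Relation.Binary.PropositionalEquality
  using (_≡_; _≢_; refl; sym; trans; cong; subst; subst₂; module ≡-Reasoning)

positive : ℕ → Bool
positive zero    = false
positive (suc _) = true

∧-elimʳ : ∀ {a b} → a ∧ b ≡ true → b ≡ true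
∧-elimʳ {true} e = e

not-true : ∀ {a} → a ≡ true → not a ≢ true
not-true refl ()

not-both : ∀ {a b} → a ∨ b ≡ true → not a ≡ true → not b ≢ true
not-both {true}         _ ()
not-both {false} {true} _ _ ()

enum : ∀ {n} (p : Fin n → Bool) → Fin (countB p) → Fin n
enum {suc n} p i with p zero
... | true with i
...   | zero   = zero
...   | suc i′ = suc (enum (p ∘ suc) i′)
enum {suc n} p i | false = suc (enum (p ∘ suc) i)

enum-true : ∀ {n} (p : Fin n → Bool) i → p (enum p i) ≡ true
enum-true {suc n} p i with p zero in eq
... | true with i
...   | zero   = eq
...   | suc i′ = enum-true (p ∘ suc) i′
enum-true {suc n} p i | false = enum-true (p ∘ suc) i

enum-injective : ∀ {n} (p : Fin n → Bool) → Injective _≡_ _≡_ (enum p)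
enum-injective {suc n} p {i} {j} e with p zero
... | false = enum-injective (p ∘ suc) (suc-injective e)
... | true with i | j | e
...   | zero   | zero   | _  = refl
...   | suc i′ | suc j′ | e′ = cong suc (enum-injective (p ∘ suc) (suc-injective e′))

rank : ∀ {n} (p : Fin n → Bool) i → p i ≡ true → Fin (countB p)
rank {suc n} p zero    pi with p zero
... | true = zero
rank {suc n} p (suc i) pi with p zero
... | true  = suc (rank (p ∘ suc) i pi)
... | false = rank (p ∘ suc) i pi

enum-rank : ∀ {n} (p : Fin n → Bool) i (pi : p i ≡ true) → enum p (rank p i pi) ≡ i
enum-rank {suc n} p zero    pi with p zero
... | true = refl
enum-rank {suc n} p (suc i) pi with p zero
... | true  = cong suc (enum-rank (p ∘ suc) i pi)
... | false = cong suc (enum-rank (p ∘ suc) i pi)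

countB-≥ : ∀ {m n} {p : Fin n → Bool} (h : Fin m → Fin n) →
           Injective _≡_ _≡_ h → (∀ r → p (h r) ≡ true) → m ≤ countB p
countB-≥ {p = p} h h-injective ph = injective⇒≤ rank∘h-injective
  where
  rank∘h-injective : Injective _≡_ _≡_ (λ r → rank p (h r) (ph r))
  rank∘h-injective {r} {s} e = h-injective (begin
    h r                     ≡⟨ enum-rank p (h r) (ph r) ⟨
    enum p (rank p (h r) _) ≡⟨ cong (enum p) e ⟩
    enum p (rank p (h s) _) ≡⟨ enum-rank p (h s) (ph s) ⟩
    h s                     ∎)
    where open ≡-Reasoning

0<countB : ∀ {n} (p : Fin n → Bool) {i} → p i ≡ true → 0 < countB p
0<countB p {i} pi = countB-≥ {1} (λ _ → i) (λ { {zero} {zero} _ → refl }) (λ _ → pi)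

positive-countB : ∀ {n} (p : Fin n → Bool) {i} → p i ≡ true → positive (countB p) ≡ true
positive-countB p pi with countB p | 0<countB p pi
... | suc _ | _ = refl

countB-cover : ∀ {n} (p q : Fin n → Bool) → (∀ i → p i ∨ q i ≡ true) → n ≤ countB p + countB q
countB-cover {zero}  p q cover = z≤n
countB-cover {suc n} p q cover
  with p zero | q zero | cover zero | countB-cover (p ∘ suc) (q ∘ suc) (cover ∘ suc)
... | true  | true  | _ | ih = s≤s (≤-trans ih (+-monoʳ-≤ (countB (p ∘ suc)) (n≤1+n _)))
... | true  | false | _ | ih = s≤s ih
... | false | true  | _ | ih = subst (suc n ≤_) (sym (+-suc _ _)) (s≤s ih)

∣tabulate∣≡countB : ∀ {n} (p : Fin n → Bool) → ∣ tabulate p ∣ ≡ countB p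
∣tabulate∣≡countB {zero}  p = refl
∣tabulate∣≡countB {suc n} p with p zero
... | true  = cong suc (∣tabulate∣≡countB (p ∘ suc))
... | false = ∣tabulate∣≡countB (p ∘ suc)

HasEdge : Digraph → Set
HasEdge A = ∃ λ u → ∃ λ v → Edge A u v

hasOut hasIn nonIsolated : (D : Digraph) → Fin (size D) → Bool
hasOut D v = positive (outdeg D v)
hasIn  D v = positive (indeg D v)
nonIsolated D v = hasOut D v ∨ hasIn D v

module _ (D : Digraph) {u v : Fin (size D)} (uv : Edge D u v) where

  hasOut-tail : hasOut D u ≡ true
  hasOut-tail = positive-countB (adj D u) uv

  hasIn-head : hasIn D v ≡ true
  hasIn-head = positive-countB (λ w → adj D w v) uv

  nonIsolated-tail : nonIsolated D u ≡ true
  nonIsolated-tail = cong (_∨ hasIn D u) hasOut-tail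

  nonIsolated-head : nonIsolated D v ≡ true
  nonIsolated-head = trans (cong (hasOut D v ∨_) hasIn-head) (∨-zeroʳ _)

minNonzero≡0 : ∀ {L} → minNonzero L ≡ 0 → All (_≡ 0) L
minNonzero≡0 {[]}        _ = []
minNonzero≡0 {zero ∷ L}  e = refl ∷ minNonzero≡0 e
minNonzero≡0 {suc _ ∷ L} e with minNonzero L
minNonzero≡0 {suc _ ∷ L} () | zero
minNonzero≡0 {suc _ ∷ L} () | suc _

minNonzero-lowerBound : ∀ {ℓ L} → ℓ ≤ minNonzero L → All (λ x → positive x ≡ true → ℓ ≤ x) L
minNonzero-lowerBound {L = []}        _  = []
minNonzero-lowerBound {L = zero ∷ L}  ℓ≤ = (λ ()) ∷ minNonzero-lowerBound ℓ≤
minNonzero-lowerBound {ℓ} {suc k ∷ L} ℓ≤ with minNonzero L in eq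
... | zero  = (λ _ → ℓ≤) ∷ All.map (λ { refl () }) (minNonzero≡0 eq)
... | suc m = (λ _ → ≤-trans ℓ≤ (m⊓n≤m (suc k) (suc m)))
            ∷ minNonzero-lowerBound (subst (ℓ ≤_) (sym eq) (≤-trans ℓ≤ (m⊓n≤n (suc k) (suc m))))

minNonzero-positive : ∀ {L} → 0 < minNonzero L → Any (λ x → positive x ≡ true) L
minNonzero-positive {zero ∷ L}  0< = there (minNonzero-positive 0<)
minNonzero-positive {suc _ ∷ L} _  = here refl

pseudoSemidegree-gap : ∀ {ℓ} D → ℓ ≤ pseudoSemidegree D → ∀ v →
  (hasOut D v ≡ true → ℓ ≤ outdeg D v) × (hasIn D v ≡ true → ℓ ≤ indeg D v)
pseudoSemidegree-gap D ℓ≤ v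
  with All.tabulate⁻ (All.map⁻ (All.concat⁻ (minNonzero-lowerBound ℓ≤))) v
... | out ∷ in′ ∷ [] = out , in′

nonIsolated-exists : ∀ D → 0 < pseudoSemidegree D → ∃ λ v → nonIsolated D v ≡ true
nonIsolated-exists D 0<
  with Any.tabulate⁻ {f = λ v → v}
         (Any.map⁻ {f = λ v → outdeg D v ∷ indeg D v ∷ []} (Any.concat⁻ _ (minNonzero-positive 0<)))
... | v , here out        = v , cong (_∨ hasIn D v) out
... | v , there (here in′) = v , trans (cong (hasOut D v ∨_) in′) (∨-zeroʳ _)

padding-bound : ∀ k m ℓ c → ℓ ≤ k → 1 ≤ m → m ≤ c + c → k * m + 3 * ℓ ≤ 8 * (k * c)
padding-bound k m ℓ c ℓ≤k 1≤m m≤2c = begin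
  k * m + 3 * ℓ       ≤⟨ +-monoʳ-≤ (k * m) (*-monoʳ-≤ 3 (≤-trans ℓ≤k (m≤m*n k m {{>-nonZero 1≤m}}))) ⟩
  4 * (k * m)         ≤⟨ *-monoʳ-≤ 4 (*-monoʳ-≤ k m≤2c) ⟩
  4 * (k * (c + c))   ≡⟨ solve 2 (λ k c → con 4 :* (k :* (c :+ c)) := con 8 :* (k :* c)) refl k c ⟩
  8 * (k * c)         ∎
  where
  open ≤-Reasoning
  open +-*-Solver

≤-double : ∀ {m a b} → m ≤ a + b → m ≤ a + a ⊎ m ≤ b + b
≤-double {a = a} {b} m≤a+b with ≤-total a b
... | inj₁ a≤b = inj₂ (≤-trans m≤a+b (+-monoˡ-≤ b a≤b))
... | inj₂ b≤a = inj₁ (≤-trans m≤a+b (+-monoʳ-≤ a b≤a))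

triangle : Fin 3 → Fin 3 → Bool
triangle 0F 1F = true
triangle 1F 2F = true
triangle 2F 0F = true
triangle _  _  = false

triangle-irreflexive : ∀ c → triangle c c ≢ true
triangle-irreflexive 0F ()
triangle-irreflexive 1F ()
triangle-irreflexive 2F ()

triangle-asymmetric : ∀ c c′ → triangle c c′ ≡ true → triangle c′ c ≢ true
triangle-asymmetric 0F 0F ()
triangle-asymmetric 0F 1F _ ()
triangle-asymmetric 0F 2F ()
triangle-asymmetric 1F 0F ()
triangle-asymmetric 1F 1F ()
triangle-asymmetric 1F 2F _ ()
triangle-asymmetric 2F 0F _ ()
triangle-asymmetric 2F 1F ()
triangle-asymmetric 2F 2F ()

triangle-successor : ∀ c → ∃ λ c′ → triangle c c′ ≡ true
triangle-successor 0F = 1F , refl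
triangle-successor 1F = 2F , refl
triangle-successor 2F = 0F , refl

triangle-predecessor : ∀ c → ∃ λ c′ → triangle c′ c ≡ true
triangle-predecessor 0F = 2F , refl
triangle-predecessor 1F = 0F , refl
triangle-predecessor 2F = 1F , refl

module Padding (D′ : Digraph) (oD′ : Oriented D′) (ℓ : ℕ) (ℓ≤δ̄ : ℓ ≤ pseudoSemidegree D′) where

  N M k : ℕ
  N = size D′
  M = countB (nonIsolated D′)
  -- N + ℓ copies make |D| ≥ N and let the 3ℓ vertices of the blow-up cost at most three copies.
  k = N + ℓ

  g : Fin M → Fin N
  g = enum (nonIsolated D′)

  Vertex : Set
  Vertex = (Fin k × Fin M) ⊎ (Fin 3 × Fin ℓ)

  pattern copy j i = inj₁ (j , i)
  pattern pad c r  = inj₂ (c , r)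

  vertexCode : Fin (k * M + 3 * ℓ) ↔ Vertex
  vertexCode = (*↔× ⊎-↔ *↔×) ↔-∘ +↔⊎

  open Inverse vertexCode using ()
    renaming (to to decode; from to encode; strictlyInverseˡ to decode-encode)
  open Injection (↔⇒↣ vertexCode) using () renaming (injective to decode-injective)
  open Injection (↔⇒↣ (↔-sym vertexCode)) using () renaming (injective to encode-injective)

  copy-injective : ∀ {j j′ i i′} → _≡_ {A = Vertex} (copy j i) (copy j′ i′) → j ≡ j′ × i ≡ i′
  copy-injective refl = refl , refl

  arc : Vertex → Vertex → Bool
  arc (copy j i) (copy j′ i′) = does (j ≟ j′) ∧ adj D′ (g i) (g i′)
  arc (copy _ i) (pad _ _)    = not (hasOut D′ (g i))
  arc (pad _ _)  (copy _ i)   = not (hasIn D′ (g i))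
  arc (pad c _)  (pad c′ _)   = triangle c c′

  D : Digraph
  D = record { size = k * M + 3 * ℓ ; adj = λ u v → arc (decode u) (decode v) }

  arc-within-copy : ∀ j {i i′} → adj D′ (g i) (g i′) ≡ true → arc (copy j i) (copy j i′) ≡ true
  arc-within-copy j e = subst (λ b → b ∧ _ ≡ true) (sym (dec-true (j ≟ j) refl)) e

  arc-irreflexive : ∀ v → arc v v ≢ true
  arc-irreflexive (copy j i) e = proj₁ oD′ (g i) (∧-elimʳ e)
  arc-irreflexive (pad c _)  e = triangle-irreflexive c e

  arc-asymmetric : ∀ u v → arc u v ≡ true → arc v u ≢ true
  arc-asymmetric (copy _ i) (copy _ i′) e e′ = proj₂ oD′ (g i) (g i′) (∧-elimʳ e) (∧-elimʳ e′)
  arc-asymmetric (copy _ i) (pad _ _)   e e′ = not-both (enum-true (nonIsolated D′) i) e e′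
  arc-asymmetric (pad _ _)  (copy _ i)  e e′ = not-both (enum-true (nonIsolated D′) i) e′ e
  arc-asymmetric (pad c _)  (pad c′ _)  e e′ = triangle-asymmetric c c′ e e′

  D-oriented : Oriented D
  D-oriented = (λ u → arc-irreflexive (decode u)) , (λ u v → arc-asymmetric (decode u) (decode v))

  vertices-≥ : ∀ {m} (q : Vertex → Bool) (h : Fin m → Vertex) →
               Injective _≡_ _≡_ h → (∀ r → q (h r) ≡ true) → m ≤ countB (q ∘ decode)
  vertices-≥ q h h-injective qh = countB-≥ (encode ∘ h) (h-injective ∘ encode-injective)
    (λ r → subst (λ u → q u ≡ true) (sym (decode-encode (h r))) (qh r))

  class-neighbours : ∀ (R : Vertex → Vertex → Bool) v c →
                     (∀ r → R v (pad c r) ≡ true) → ℓ ≤ countB (R v ∘ decode)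
  class-neighbours R v c = vertices-≥ (R v) (pad c) (λ { refl → refl })

  module _ (E : Fin N → Fin N → Bool) (R : Vertex → Vertex → Bool)
    (E-nonIsolated : ∀ {w u} → E w u ≡ true → nonIsolated D′ u ≡ true)
    (E⇒R : ∀ j {i i′} → E (g i) (g i′) ≡ true → R (copy j i) (copy j i′) ≡ true) where

    copy-neighbours : ∀ j i → countB (E (g i)) ≤ countB (λ u → R (copy j i) (decode u))
    copy-neighbours j i = vertices-≥ (R (copy j i)) (copy j ∘ index) index-injective R-index
      where
      index : Fin (countB (E (g i))) → Fin M
      index r = rank (nonIsolated D′) (enum (E (g i)) r) (E-nonIsolated (enum-true (E (g i)) r))

      g∘index : ∀ r → g (index r) ≡ enum (E (g i)) r
      g∘index r = enum-rank (nonIsolated D′) _ _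

      index-injective : Injective _≡_ _≡_ (copy j ∘ index)
      index-injective {r} {s} e = enum-injective (E (g i))
        (trans (sym (g∘index r)) (trans (cong g (proj₂ (copy-injective e))) (g∘index s)))

      R-index : ∀ r → R (copy j i) (copy j (index r)) ≡ true
      R-index r = E⇒R j (subst (λ u → E (g i) u ≡ true) (sym (g∘index r)) (enum-true (E (g i)) r))

    copy-degree : (∀ w → positive (countB (E w)) ≡ true → ℓ ≤ countB (E w)) →
                  (∀ {j i c r} → positive (countB (E (g i))) ≡ false → R (copy j i) (pad c r) ≡ true) →
                  ∀ j i → ℓ ≤ countB (λ u → R (copy j i) (decode u))
    copy-degree gap toPad j i with positive (countB (E (g i))) in eq
    ... | true  = ≤-trans (gap (g i) eq) (copy-neighbours j i)
    ... | false = class-neighbours R (copy j i) 0F (λ _ → toPad eq)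

  D-minSemidegree : MinSemidegreeAtLeast D ℓ
  D-minSemidegree u = out-degree (decode u) , in-degree (decode u)
    where
    gap = pseudoSemidegree-gap D′ ℓ≤δ̄

    out-degree : ∀ v → ℓ ≤ countB (λ u → arc v (decode u))
    out-degree (copy j i) = copy-degree (adj D′) arc (nonIsolated-head D′) arc-within-copy
                              (proj₁ ∘ gap) (cong not) j i
    out-degree (pad c r)  = class-neighbours arc (pad c r) _ (λ _ → proj₂ (triangle-successor c))

    in-degree : ∀ v → ℓ ≤ countB (λ u → arc (decode u) v)
    in-degree (copy j i) = copy-degree (flip (adj D′)) (flip arc) (nonIsolated-tail D′)
                             (λ j → arc-within-copy j) (proj₂ ∘ gap) (cong not) j i
    in-degree (pad c r)  =
      class-neighbours (flip arc) (pad c r) _ (λ _ → proj₂ (triangle-predecessor c))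

  0<M : 0 < ℓ → 0 < M
  0<M 0<ℓ = 0<countB (nonIsolated D′) (proj₂ (nonIsolated-exists D′ (≤-trans 0<ℓ ℓ≤δ̄)))

  size-≥ : 1 ≤ M → N ≤ size D
  size-≥ 1≤M =
    ≤-trans (m≤m+n N ℓ) (≤-trans (m≤m*n k M {{>-nonZero 1≤M}}) (m≤m+n (k * M) (3 * ℓ)))

  hosts : (Fin N → Bool) → Vertex → Bool
  hosts p (copy _ i) = p (g i)
  hosts p (pad _ _)  = false

  V* : (Fin N → Bool) → Subset (size D)
  V* p = tabulate (hosts p ∘ decode)

  ∣V*∣-≥ : ∀ p → k * countB (p ∘ g) ≤ ∣ V* p ∣
  ∣V*∣-≥ p = subst (k * c ≤_) (sym (∣tabulate∣≡countB (hosts p ∘ decode)))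
    (vertices-≥ (hosts p) (host ∘ Inverse.to *↔×) (*↔×-injective ∘ host-injective)
                (λ _ → enum-true (p ∘ g) _))
    where
    c = countB (p ∘ g)
    open Injection (↔⇒↣ (*↔× {k} {c})) using () renaming (injective to *↔×-injective)

    host : Fin k × Fin c → Vertex
    host (j , r) = copy j (enum (p ∘ g) r)

    host-injective : Injective _≡_ _≡_ host
    host-injective {j , r} {j′ , r′} e with copy-injective e
    ... | refl , i≡ = cong (j ,_) (enum-injective (p ∘ g) i≡)

  size-≤-8∣V*∣ : ∀ p → 1 ≤ M → M ≤ countB (p ∘ g) + countB (p ∘ g) → size D ≤ 8 * ∣ V* p ∣
  size-≤-8∣V*∣ p 1≤M M≤2c =
    ≤-trans (padding-bound k M ℓ _ (m≤n+m ℓ N) 1≤M M≤2c) (*-monoʳ-≤ 8 (∣V*∣-≥ p))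

  module _ (A : Digraph) (wcA : WeaklyConnected A) (antiA : Antidirected A) where

    -- If g i hosts a, no arc of D at a copy of g i matching an arc of A at a leads to the blow-up.
    Hosts : Fin (size A) → Fin M → Set
    Hosts a i = (∀ {b} → Edge A a b → hasOut D′ (g i) ≡ true) ×
                (∀ {b} → Edge A b a → hasIn D′ (g i) ≡ true)

    module _ (f : Fin (size A) → Fin (size D)) (f-embedding : IsEmbedding A D f) (j : Fin k) where

      record InCopy (a : Fin (size A)) : Set where
        constructor placed
        field
          index   : Fin M
          located : decode (f a) ≡ copy j index
          hosted  : Hosts a index
      open InCopy

      f-arc : ∀ {a b} → Edge A a b → arc (decode (f a)) (decode (f b)) ≡ true
      f-arc {a} {b} = proj₂ f-embedding a b

      inCopy-head : ∀ {a b} → Edge A a b → InCopy a → InCopy b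
      inCopy-head {a} {b} ab (placed i fa (out , _)) =
        step (decode (f b)) refl (subst (λ v → arc v (decode (f b)) ≡ true) fa (f-arc ab))
        where
        step : ∀ v → decode (f b) ≡ v → arc (copy j i) v ≡ true → InCopy b
        step (copy j′ i′) fb e with j ≟ j′
        ... | yes refl = placed i′ fb ((λ bc → ⊥-elim (antiA a b _ ab bc)) , (λ _ → hasIn-head D′ e))
        step (copy j′ i′) fb () | no _
        step (pad _ _)    fb e = ⊥-elim (not-true (out ab) e)

      inCopy-tail : ∀ {a b} → Edge A a b → InCopy b → InCopy a
      inCopy-tail {a} {b} ab (placed i fb (_ , in′)) =
        step (decode (f a)) refl (subst (λ v → arc (decode (f a)) v ≡ true) fb (f-arc ab))
        where
        step : ∀ v → decode (f a) ≡ v → arc v (copy j i) ≡ true → InCopy a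
        step (copy j′ i′) fa e with j′ ≟ j
        ... | yes refl = placed i′ fa ((λ _ → hasOut-tail D′ e) , (λ ca → ⊥-elim (antiA _ a b ca ab)))
        step (copy j′ i′) fa () | no _
        step (pad _ _)    fa e = ⊥-elim (not-true (in′ ab) e)

      inCopy-reach : ∀ {a b} → Reach A a b → InCopy a → InCopy b
      inCopy-reach here        = λ p → p
      inCopy-reach (fwd r ab)  = inCopy-head ab ∘ inCopy-reach r
      inCopy-reach (bwd r ba)  = inCopy-tail ba ∘ inCopy-reach r

      InCopy⇒contains : ∀ {a₀} → InCopy a₀ → Contains D′ A
      InCopy⇒contains {a₀} p₀ = g ∘ index ∘ place , place-injective , place-edge
        where
        place : ∀ a → InCopy a
        place a = inCopy-reach (wcA a₀ a) p₀

        place-injective : Injective _≡_ _≡_ (g ∘ index ∘ place)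
        place-injective {a} {b} e = proj₁ f-embedding (decode-injective (begin
          decode (f a)                 ≡⟨ located (place a) ⟩
          copy j (index (place a))     ≡⟨ cong (copy j) (enum-injective (nonIsolated D′) e) ⟩
          copy j (index (place b))     ≡⟨ located (place b) ⟨
          decode (f b)                 ∎))
          where open ≡-Reasoning

        place-edge : ∀ a b → Edge A a b → Edge D′ (g (index (place a))) (g (index (place b)))
        place-edge a b ab =
          ∧-elimʳ (subst₂ (λ u v → arc u v ≡ true) (located (place a)) (located (place b)) (f-arc ab))

    large-V*⇒contains : RobustEmbeds8 A D → 1 ≤ M → ∀ p → M ≤ countB (p ∘ g) + countB (p ∘ g) →
                       ∀ a → (∀ {i} → p (g i) ≡ true → Hosts a i) → Contains D′ A
    large-V*⇒contains robust 1≤M p M≤2c a host with robust (V* p) (size-≤-8∣V*∣ p 1≤M M≤2c) a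
    ... | f , f-embedding , fa∈V* =
      start (decode (f a)) refl
        (trans (sym (lookup∘tabulate (hosts p ∘ decode) (f a))) ([]=⇒lookup fa∈V*))
      where
      start : ∀ v → decode (f a) ≡ v → hosts p v ≡ true → Contains D′ A
      start (copy j i) fa pi = InCopy⇒contains f f-embedding j (placed i fa (host pi))
      start (pad _ _)  _  ()

    robust⇒contains : RobustEmbeds8 A D → 1 ≤ M → ∀ {x y} → Edge A x y → Contains D′ A
    robust⇒contains robust 1≤M {x} {y} xy
      with ≤-double {a = countB (hasOut D′ ∘ g)} {b = countB (hasIn D′ ∘ g)}
             (countB-cover (hasOut D′ ∘ g) (hasIn D′ ∘ g) (enum-true (nonIsolated D′)))
    ... | inj₁ M≤2out = large-V*⇒contains robust 1≤M (hasOut D′) M≤2out x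
                          (λ out → (λ _ → out) , (λ bx → ⊥-elim (antiA _ x y bx xy)))
    ... | inj₂ M≤2in  = large-V*⇒contains robust 1≤M (hasIn D′) M≤2in y
                          (λ in′ → (λ yb → ⊥-elim (antiA x y _ xy yb)) , (λ _ → in′))

inhabited? : ∀ n → Dec (Fin n)
inhabited? zero    = no λ ()
inhabited? (suc n) = yes zero

edge? : ∀ A → Dec (HasEdge A)
edge? A = any? λ u → any? λ v → adj A u v ≟ᵇ true

contains-empty : ∀ D {A} → ¬ Fin (size A) → Contains D A
contains-empty D ¬a = (λ a → ⊥-elim (¬a a)) , (λ {a} → ⊥-elim (¬a a)) , (λ a → ⊥-elim (¬a a))

contains-edgeless : ∀ D {A} → WeaklyConnected A → ¬ HasEdge A → Fin (size D) → Contains D A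
contains-edgeless D {A} wcA noEdge v =
  (λ _ → v) , (λ {a} {b} _ → reach-edgeless (wcA a b)) , λ a b ab → ⊥-elim (noEdge (a , b , ab))
  where
  reach-edgeless : ∀ {a b} → Reach A a b → a ≡ b
  reach-edgeless here      = refl
  reach-edgeless (fwd _ e) = ⊥-elim (noEdge (_ , _ , e))
  reach-edgeless (bwd _ e) = ⊥-elim (noEdge (_ , _ , e))

RobustEmbeds8⇒Contains : ∀ D {A} → Fin (size A) → RobustEmbeds8 A D → Contains D A
RobustEmbeds8⇒Contains D a robust = map₂ proj₁ (robust ⊤ D≤8∣⊤∣ a)
  where
  D≤8∣⊤∣ : size D ≤ 8 * ∣ ⊤ {size D} ∣
  D≤8∣⊤∣ = subst (λ m → size D ≤ 8 * m) (sym (∣⊤∣≡n (size D))) (m≤m+n (size D) (7 * size D))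

lemma10 : (A : Digraph) → Oriented A → WeaklyConnected A → Antidirected A →
          (ℓ n₀ : ℕ) →
          ((D : Digraph) → Oriented D → n₀ ≤ size D →
             MinSemidegreeAtLeast D ℓ → RobustEmbeds8 A D) →
          (D′ : Digraph) → Oriented D′ → n₀ ≤ size D′ →
          ℓ ≤ pseudoSemidegree D′ → Contains D′ A
lemma10 A _ wcA antiA ℓ n₀ H D′ oD′ n₀≤N ℓ≤δ̄ with inhabited? (size A) | ℓ | edge? A
... | no ¬a | _      | _ = contains-empty D′ ¬a
... | yes a | zero   | _ = RobustEmbeds8⇒Contains D′ a (H D′ oD′ n₀≤N (λ _ → z≤n , z≤n))
... | yes _ | suc _  | no noEdge =
  contains-edgeless D′ wcA noEdge (proj₁ (nonIsolated-exists D′ (≤-trans (s≤s z≤n) ℓ≤δ̄)))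
... | yes _ | suc ℓ′ | yes (_ , _ , xy) =
  robust⇒contains A wcA antiA (H D D-oriented (≤-trans n₀≤N (size-≥ 0<M′)) D-minSemidegree) 0<M′ xy
  where
  open Padding D′ oD′ (suc ℓ′) ℓ≤δ̄
  0<M′ : 0 < M
  0<M′ = 0<M (s≤s z≤n)
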